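{- Let $G$ and $H$ be (finite, simple, connected) graphs. If $\beta(G\,\square\,H)=2$, then $G$ or $H$ is a path.
   Context: $d(v,w)$ denotes shortest-path distance. A vertex $x$ resolves $v,w$ if $d(v,x)\neq d(w,x)$; a set resolves a graph if every pair of distinct vertices is resolved by some vertex of the set; $\beta(G)$ is the minimum size of a resolving set. The cartesian product $G\,\square\,H$ has vertex set $V(G)\times V(H)$, with $(a,v)\sim(b,w)$ iff ($a=b$ and $vw\in E(H)$) or ($v=w$ and $ab\in E(G)$). -}

module Defs where

open import Level using (0ℓ)
open import Data.Nat using (ℕ; zero; suc; _<_; _≤_; _∸_; _+_)
open import Data.Fin using (Fin; toℕ)
open import Data.Product using (Σ; _×_; _,_; ∃)
open import Data.Sum using (_⊎_; inj₁; inj₂)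
import Relation.Binary.PropositionalEquality as Eq
open import Data.List using (List; length)
open import Data.List.Membership.Propositional using (_∈_)
open import Data.List.Relation.Unary.Unique.Propositional using (Unique)
open import Relation.Binary.PropositionalEquality using (_≡_; _≢_)
open import Relation.Nullary using (¬_)
open import Function.Bundles using (_↔_; _⇔_; Inverse)

record Graph : Set₁ where
  field
    V     : Set
    Adj   : V → V → Set
    sym   : ∀ {u v} → Adj u v → Adj v u
    irrfl : ∀ {u} → ¬ Adj u u
open Graph public

Finite : Graph → Set
Finite G = Σ ℕ λ n → Fin n ↔ V G

data Walk (G : Graph) : V G → V G → ℕ → Set where
  nil  : ∀ {u} → Walk G u u 0
  cons : ∀ {u w v k} → Adj G u w → Walk G w v k → Walk G u v (suc k)

Connected : Graph → Set
Connected G = ∀ (u v : V G) → ∃ λ k → Walk G u v k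

Dist : (G : Graph) → V G → V G → ℕ → Set
Dist G u v k = Walk G u v k × (∀ m → m < k → ¬ Walk G u v m)

Resolves : (G : Graph) → V G → V G → V G → Set
Resolves G x v w = ∀ a b → Dist G v x a → Dist G w x b → a ≢ b

Resolving : (G : Graph) → List (V G) → Set
Resolving G S = ∀ v w → v ≢ w → ∃ λ x → x ∈ S × Resolves G x v w

MetricDim : Graph → ℕ → Set
MetricDim G k =
  (Σ (List (V G)) λ S → Unique S × Resolving G S × length S ≡ k)
  × (∀ S → Unique S → Resolving G S → k ≤ length S)

ProdAdj : (G H : Graph) → V G × V H → V G × V H → Set
ProdAdj G H (a , v) (b , w) = (a ≡ b × Adj H v w) ⊎ (v ≡ w × Adj G a b)

prodSym : (G H : Graph) → ∀ {x y} → ProdAdj G H x y → ProdAdj G H y x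
prodSym G H {a , v} {b , w} (inj₁ (e , p)) = inj₁ (Eq.sym e , sym H p)
prodSym G H {a , v} {b , w} (inj₂ (e , p)) = inj₂ (Eq.sym e , sym G p)

prodIrr : (G H : Graph) → ∀ {x} → ¬ ProdAdj G H x x
prodIrr G H {a , v} (inj₁ (_ , p)) = irrfl H p
prodIrr G H {a , v} (inj₂ (_ , p)) = irrfl G p

_□_ : Graph → Graph → Graph
G □ H = record
  { V     = V G × V H
  ; Adj   = ProdAdj G H
  ; sym   = prodSym G H
  ; irrfl = prodIrr G H
  }

Consecutive : ℕ → ℕ → Set
Consecutive i j = suc i ≡ j ⊎ suc j ≡ i

IsPath : Graph → Set
IsPath G = Σ ℕ λ n → 1 ≤ n × Σ (Fin n ↔ V G) λ f →
  ∀ i j → Adj G (Inverse.to f i) (Inverse.to f j) ⇔ Consecutive (toℕ i) (toℕ j)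

-- Distances in G □ H add up: d((g, h), (g′, h′)) = d(g, g′) + d(h, h′).
-- Let (a₁, h₁) and (a₂, h₂) resolve G □ H. If a₁ ≠ a₂ and h₁ ≠ h₂, let g and k be
-- the first steps of shortest paths from a₁ to a₂ and from h₁ to h₂: then (g, h₁)
-- and (a₁, k) are both at distance 1 from (a₁, h₁) and at distance
-- d(a₁, a₂) + d(h₁, h₂) - 1 from (a₂, h₂). So, say, a₁ = a₂; then (u, h) and (w, h)
-- are resolved only if d(u, a₁) ≠ d(w, a₁), i.e. a₁ alone resolves G.
-- A graph resolved by one vertex a is a path: distinct vertices have distinct
-- distances to a and neighbours' distances differ by one, so the vertices at
-- distance 0, 1, …, max line up.
module Submission where

open import Defs
open import Data.Sum using (_⊎_; inj₁; inj₂; [_,_])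
open import Data.Empty using (⊥; ⊥-elim)
open import Data.Fin using (Fin; toℕ; fromℕ<)
open import Data.Fin.Properties using (toℕ≤pred[n]; toℕ-fromℕ<; toℕ-injective; inj⇒≟)
open import Data.List using (List; []; _∷_; map; allFin)
open import Data.List.Extrema.Nat using (argmax; f[xs]≤f[argmax])
open import Data.List.Membership.Propositional using (_∈_)
open import Data.List.Membership.Propositional.Properties using (∈-allFin; ∈-map⁺)
open import Data.List.Relation.Unary.All as All using (All; []; _∷_)
open import Data.List.Relation.Unary.Any using (here; there)
open import Data.Nat using (ℕ; zero; suc; _+_; _≤_; _<_; z≤n; s≤s)
open import Data.Nat.Induction using (<-rec)
open import Data.Nat.Properties
  using (≤-trans; ≤-antisym; ≤-pred; ≮⇒≥; <⇒≱; <-cmp; +-mono-≤; +-suc; m≤n⇒m<n∨m≡n)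
open import Data.Product using (Σ; ∃; ∃₂; _×_; _,_; proj₁; proj₂)
open import Function using (_∘_)
open import Function.Bundles using (_⇔_; Inverse; mk⇔; mk↔ₛ′)
open import Function.Properties.Inverse using (↔-sym; ↔⇒↣)
open import Relation.Binary using (tri<; tri≈; tri>)
open import Relation.Binary.Definitions using (DecidableEquality)
open import Relation.Binary.PropositionalEquality
  using (_≡_; _≢_; refl; cong; subst; trans) renaming (sym to ≡-sym)
open import Relation.Nullary using (¬_; yes; no)
open import Relation.Nullary.Decidable using (decidable-stable; ¬¬-excluded-middle)

m≢n⇒Consecutive : ∀ {m n} → m ≢ n → n ≤ suc m → m ≤ suc n → Consecutive m n
m≢n⇒Consecutive {m} {n} m≢n n≤1+m m≤1+n with <-cmp m n
... | tri< m<n _ _ = inj₁ (≤-antisym m<n n≤1+m)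
... | tri≈ _ m≡n _ = ⊥-elim (m≢n m≡n)
... | tri> _ _ n<m = inj₂ (≤-antisym n<m m≤1+n)

module _ (X : Graph) where

  finite⇒≟ : Finite X → DecidableEquality (V X)
  finite⇒≟ (_ , Fin↔V) = inj⇒≟ (↔⇒↣ (↔-sym Fin↔V))

  finite⇒enumeration : Finite X → Σ (List (V X)) λ vs → ∀ v → v ∈ vs
  finite⇒enumeration (n , Fin↔V) = map to (allFin n) , ∈-enumeration
    where
    open Inverse Fin↔V
    ∈-enumeration : ∀ v → v ∈ map to (allFin n)
    ∈-enumeration v =
      subst (_∈ map to (allFin n)) (strictlyInverseˡ v) (∈-map⁺ to (∈-allFin (from v)))

  dist-refl : ∀ u → Dist X u u 0
  dist-refl u = nil , λ _ ()

  dist0⇒≡ : ∀ {u v} → Dist X u v 0 → u ≡ v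
  dist0⇒≡ (nil , _) = refl

  adj⇒dist1 : ∀ {u v} → Adj X u v → Dist X u v 1
  adj⇒dist1 u~v = cons u~v nil , λ where
    zero _ nil → irrfl X u~v
    (suc _) (s≤s ()) _

  dist≤walk : ∀ {u v ℓ m} → Dist X u v ℓ → Walk X u v m → ℓ ≤ m
  dist≤walk {m = m} (_ , minimal) w = ≮⇒≥ λ m<ℓ → minimal m m<ℓ w

  dist-unique : ∀ {u v i j} → Dist X u v i → Dist X u v j → i ≡ j
  dist-unique di dj = ≤-antisym (dist≤walk di (proj₁ dj)) (dist≤walk dj (proj₁ di))

  dist-step : ∀ {u v k} → Dist X u v (suc k) → ∃ λ w → Adj X u w × Dist X w v k
  dist-step (cons u~w w , minimal) =
    _ , u~w , w , λ m m<k w′ → minimal (suc m) (s≤s m<k) (cons u~w w′)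

  adj⇒dist≤suc : ∀ {u w v i j} → Adj X u w → Dist X u v i → Dist X w v j → j ≤ suc i
  adj⇒dist≤suc u~w du dw = dist≤walk dw (cons (sym X u~w) (proj₁ du))

  vertex-at : ∀ {u v m i} → Dist X u v m → i ≤ m → ∃ λ w → Dist X w v i
  vertex-at du i≤m with m≤n⇒m<n∨m≡n i≤m
  ... | inj₂ refl = _ , du
  ... | inj₁ (s≤s i≤m′) = vertex-at (proj₂ (proj₂ (dist-step du))) i≤m′

  -- Only a double negation: without decidable adjacency the minimum length of a walk
  -- cannot be computed.
  walk⇒¬¬dist : ∀ {u v k} → Walk X u v k → ¬ ¬ ∃ (Dist X u v)
  walk⇒¬¬dist {u} {v} {k} = <-rec (λ k → Walk X u v k → ¬ ¬ ∃ (Dist X u v)) shortest k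
    where
    shortest : ∀ k → (∀ {m} → m < k → Walk X u v m → ¬ ¬ ∃ (Dist X u v)) →
      Walk X u v k → ¬ ¬ ∃ (Dist X u v)
    shortest k shorter w ¬dist =
      ¬¬-excluded-middle {A = ∃ λ m → m < k × Walk X u v m} λ where
        (yes (m , m<k , w′)) → shorter m<k w′ ¬dist
        (no ∄shorter) → ¬dist (k , w , λ m m<k w′ → ∄shorter (m , m<k , w′))

  connected⇒¬¬dist : Connected X → ∀ u v → ¬ ¬ ∃ (Dist X u v)
  connected⇒¬¬dist connected u v = walk⇒¬¬dist (proj₂ (connected u v))

  walk-++ : ∀ {u v w p q} → Walk X u v p → Walk X v w q → Walk X u w (p + q)
  walk-++ nil w′ = w′
  walk-++ (cons e w) w′ = cons e (walk-++ w w′)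

module _ {G H : Graph} where

  walk-□ᴳ : ∀ {g g′ p} → Walk G g g′ p → ∀ h → Walk (G □ H) (g , h) (g′ , h) p
  walk-□ᴳ nil h = nil
  walk-□ᴳ (cons e w) h = cons (inj₂ (refl , e)) (walk-□ᴳ w h)

  walk-□ᴴ : ∀ {h h′ q} g → Walk H h h′ q → Walk (G □ H) (g , h) (g , h′) q
  walk-□ᴴ g nil = nil
  walk-□ᴴ g (cons e w) = cons (inj₁ (refl , e)) (walk-□ᴴ g w)

  □-walk⇒walks : ∀ {g g′ h h′ m} → Walk (G □ H) (g , h) (g′ , h′) m →
    ∃₂ λ p q → p + q ≡ m × Walk G g g′ p × Walk H h h′ q
  □-walk⇒walks nil = 0 , 0 , refl , nil , nil
  □-walk⇒walks (cons (inj₁ (refl , e)) w) with □-walk⇒walks w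
  ... | p , q , refl , wG , wH = p , suc q , +-suc p q , wG , cons e wH
  □-walk⇒walks (cons (inj₂ (refl , e)) w) with □-walk⇒walks w
  ... | p , q , refl , wG , wH = suc p , q , refl , cons e wG , wH

  dist-□ : ∀ {g g′ h h′ p q} → Dist G g g′ p → Dist H h h′ q →
    Dist (G □ H) (g , h) (g′ , h′) (p + q)
  dist-□ {g′ = g′} {h = h} (wG , _) (wH , _) .proj₁ =
    walk-++ (G □ H) (walk-□ᴳ wG h) (walk-□ᴴ g′ wH)
  dist-□ dG dH .proj₂ m m<p+q w with □-walk⇒walks w
  ... | _ , _ , refl , wG , wH =
    <⇒≱ m<p+q (+-mono-≤ (dist≤walk G dG wG) (dist≤walk H dH wH))

module _ (G : Graph) (finite : Finite G) (connected : Connected G)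
         (a : V G) (resolving : Resolving G (a ∷ [])) where

  private
    _≟_ : DecidableEquality (V G)
    _≟_ = finite⇒≟ G finite

    dist-injective : ∀ {u w k} → Dist G u a k → Dist G w a k → u ≡ w
    dist-injective {u} {w} du dw =
      decidable-stable (u ≟ w) λ u≢w → unresolved (resolving u w u≢w)
      where
      unresolved : ¬ ∃ λ x → x ∈ a ∷ [] × Resolves G x u w
      unresolved (_ , here refl , a-resolves) = a-resolves _ _ du dw refl

    farther : ∀ {x y z j} → Dist G x a j → Dist G y a (suc j) → Adj G y z → z ≢ x →
      Dist G z a (suc (suc j))
    farther {x} {y} {z} {j} dx dy y~z z≢x = cons (sym G y~z) (proj₁ dy) , no-shortcut
      where
      closer : ∀ {ℓ} → Dist G z a ℓ → ℓ ≤ suc j → ⊥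
      closer {ℓ} dz ℓ≤1+j with m≤n⇒m<n∨m≡n ℓ≤1+j
      ... | inj₁ ℓ<1+j = z≢x (dist-injective dz (subst (Dist G x a) j≡ℓ dx))
        where
        j≡ℓ : j ≡ ℓ
        j≡ℓ = ≤-antisym (≤-pred (adj⇒dist≤suc G (sym G y~z) dz dy)) (≤-pred ℓ<1+j)
      ... | inj₂ refl = irrfl G (subst (Adj G y) (dist-injective dz dy) y~z)

      no-shortcut : ∀ m → m < suc (suc j) → ¬ Walk G z a m
      no-shortcut m m<2+j w = walk⇒¬¬dist G w λ (_ , dz) →
        closer dz (≤-trans (dist≤walk G dz w) (≤-pred m<2+j))

    -- Distances to a are computed along a walk from a: a neighbour of a vertex at distance
    -- i + 1 is either its predecessor on a shortest walk or at distance i + 2.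
    neighbour-dist : ∀ {y z i} → Dist G y a i → Adj G y z → ∃ (Dist G z a)
    neighbour-dist {i = zero} (nil , _) a~z = 1 , adj⇒dist1 G (sym G a~z)
    neighbour-dist {z = z} {i = suc i} dy y~z with dist-step G dy
    ... | x , _ , dx with z ≟ x
    ... | yes refl = i , dx
    ... | no z≢x = suc (suc i) , farther dx dy y~z z≢x

    dist-along : ∀ {y z i k} → Dist G y a i → Walk G y z k → ∃ (Dist G z a)
    dist-along dy nil = _ , dy
    dist-along dy (cons e w) = dist-along (proj₂ (neighbour-dist dy e)) w

    reach : ∀ z → ∃ (Dist G z a)
    reach z = dist-along (dist-refl G a) (proj₂ (connected a z))

    level : V G → ℕ
    level = proj₁ ∘ reach

    level-dist : ∀ z → Dist G z a (level z)
    level-dist = proj₂ ∘ reach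

    adj⇒consecutive : ∀ {x y i j} → Dist G x a i → Dist G y a j → Adj G x y →
      Consecutive i j
    adj⇒consecutive {x} {y} {i} {j} dx dy x~y = m≢n⇒Consecutive i≢j
      (adj⇒dist≤suc G x~y dx dy) (adj⇒dist≤suc G (sym G x~y) dy dx)
      where
      i≢j : i ≢ j
      i≢j i≡j = irrfl G (subst (Adj G x) (≡-sym x≡y) x~y)
        where
        x≡y : x ≡ y
        x≡y = dist-injective dx (subst (Dist G y a) (≡-sym i≡j) dy)

    consecutive⇒adj : ∀ {x y i j} → Dist G x a i → Dist G y a j → suc i ≡ j → Adj G x y
    consecutive⇒adj dx dy refl with dist-step G dy
    ... | _ , y~x′ , dx′ = sym G (subst (Adj G _) (dist-injective dx′ dx) y~x′)

    adj⇔consecutive : ∀ {x y i j} → Dist G x a i → Dist G y a j →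
      Adj G x y ⇔ Consecutive i j
    adj⇔consecutive dx dy = mk⇔ (adj⇒consecutive dx dy)
      [ consecutive⇒adj dx dy , sym G ∘ consecutive⇒adj dy dx ]

    far : V G
    far = argmax level a (proj₁ (finite⇒enumeration G finite))

    level≤far : ∀ v → level v ≤ level far
    level≤far v = All.lookup (f[xs]≤f[argmax] a vs) (∈vs v)
      where open Σ (finite⇒enumeration G finite) renaming (proj₁ to vs; proj₂ to ∈vs)

    at : Fin (suc (level far)) → V G
    at i = proj₁ (vertex-at G (level-dist far) (toℕ≤pred[n] i))

    at-dist : ∀ i → Dist G (at i) a (toℕ i)
    at-dist i = proj₂ (vertex-at G (level-dist far) (toℕ≤pred[n] i))

    index : V G → Fin (suc (level far))
    index v = fromℕ< (s≤s (level≤far v))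

    at-index : ∀ v → at (index v) ≡ v
    at-index v =
      dist-injective (subst (Dist G _ a) (toℕ-fromℕ< _) (at-dist (index v))) (level-dist v)

    index-at : ∀ i → index (at i) ≡ i
    index-at i =
      toℕ-injective (trans (toℕ-fromℕ< _) (dist-unique G (level-dist (at i)) (at-dist i)))

  resolved-by-vertex⇒path : IsPath G
  resolved-by-vertex⇒path =
    suc (level far) , s≤s z≤n , mk↔ₛ′ at index at-index index-at ,
    λ i j → adj⇔consecutive (at-dist i) (at-dist j)

module _ {G H : Graph} where

  resolving-in-H-layer⇒resolving : Connected H → ∀ a (h : V H) {S} →
    All ((a ≡_) ∘ proj₁) S → Resolving (G □ H) S → Resolving G (a ∷ [])
  resolving-in-H-layer⇒resolving connected a h in-layer resolving u w u≢w =
    a , here refl , a-resolves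
    where
    a-resolves : Resolves G a u w
    a-resolves i j du dw i≡j with resolving (u , h) (w , h) (u≢w ∘ cong proj₁)
    ... | (_ , h′) , x∈S , x-resolves with All.lookup in-layer x∈S
    ... | refl = connected⇒¬¬dist H connected h h′ λ (q , dq) →
      x-resolves _ _ (dist-□ du dq) (dist-□ dw dq) (cong (_+ q) i≡j)

  resolving-in-G-layer⇒resolving : Connected G → ∀ (g : V G) h {S} →
    All ((h ≡_) ∘ proj₂) S → Resolving (G □ H) S → Resolving H (h ∷ [])
  resolving-in-G-layer⇒resolving connected g h in-layer resolving u w u≢w =
    h , here refl , h-resolves
    where
    h-resolves : Resolves H h u w
    h-resolves i j du dw i≡j with resolving (g , u) (g , w) (u≢w ∘ cong proj₂)
    ... | (g′ , _) , x∈S , x-resolves with All.lookup in-layer x∈S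
    ... | refl = connected⇒¬¬dist G connected g g′ λ (p , dp) →
      x-resolves _ _ (dist-□ dp du) (dist-□ dp dw) (cong (p +_) i≡j)

  ¬resolving-off-layers : Connected G → Connected H →
    ∀ {a₁ a₂ h₁ h₂} → a₁ ≢ a₂ → h₁ ≢ h₂ →
    ¬ Resolving (G □ H) ((a₁ , h₁) ∷ (a₂ , h₂) ∷ [])
  ¬resolving-off-layers connectedG connectedH {a₁} {a₂} {h₁} {h₂} a₁≢a₂ h₁≢h₂ res =
    connected⇒¬¬dist G connectedG a₁ a₂ λ (_ , dG) →
    connected⇒¬¬dist H connectedH h₁ h₂ λ (_ , dH) → unresolved dG dH
    where
    unresolved : ∀ {p q} → Dist G a₁ a₂ p → Dist H h₁ h₂ q → ⊥
    unresolved {zero} dG _ = a₁≢a₂ (dist0⇒≡ G dG)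
    unresolved {suc _} {zero} _ dH = h₁≢h₂ (dist0⇒≡ H dH)
    unresolved {suc p} {suc q} dG dH
      with dist-step G dG | dist-step H dH
    ... | g , a₁~g , dg | k , h₁~k , dk
      with res (g , h₁) (a₁ , k) (λ eq → irrfl G (subst (Adj G a₁) (cong proj₁ eq) a₁~g))
    ... | _ , here refl , x-resolves =
      x-resolves 1 1 (dist-□ (adj⇒dist1 G (sym G a₁~g)) (dist-refl H h₁))
                     (dist-□ (dist-refl G a₁) (adj⇒dist1 H (sym H h₁~k))) refl
    ... | _ , there (here refl) , x-resolves =
      x-resolves _ _ (dist-□ dg dH) (dist-□ dG dk) (+-suc p q)

lemma7p2 : (G H : Graph) → Finite G → Finite H → Connected G → Connected H →
    MetricDim (G □ H) 2 → IsPath G ⊎ IsPath H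
lemma7p2 G H finiteG finiteH connectedG connectedH
  (((a₁ , h₁) ∷ (a₂ , h₂) ∷ [] , _ , resolving , _) , _)
  with finite⇒≟ G finiteG a₁ a₂ | finite⇒≟ H finiteH h₁ h₂
... | yes refl | _ = inj₁ (resolved-by-vertex⇒path G finiteG connectedG a₁
      (resolving-in-H-layer⇒resolving connectedH a₁ h₁ (refl ∷ refl ∷ []) resolving))
... | no _ | yes refl = inj₂ (resolved-by-vertex⇒path H finiteH connectedH h₁
      (resolving-in-G-layer⇒resolving connectedG a₁ h₁ (refl ∷ refl ∷ []) resolving))
... | no a₁≢a₂ | no h₁≢h₂ =
      ⊥-elim (¬resolving-off-layers connectedG connectedH a₁≢a₂ h₁≢h₂ resolving)
lemma7p2 _ _ _ _ _ _ (([] , _ , _ , ()) , _)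
lemma7p2 _ _ _ _ _ _ ((_ ∷ [] , _ , _ , ()) , _)
lemma7p2 _ _ _ _ _ _ ((_ ∷ _ ∷ _ ∷ _ , _ , _ , ()) , _)
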